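{- Let $a,b$ be positive integers with $\gcd(a,b)=1$ and $a\ge3$ odd, and let $x_1,y_1,x_2,y_2$ be positive integers with $2b x_1-2a y_1=a-1$ and $b x_2-a y_2=1$. Let $H=(V_H,E_H)$ be a connected graph in which every vertex has exactly three neighbors, and let $k$ be an integer. Construct the graph $G$ as follows: for every $v\in V_H$ create a vertex $v^*$; for every $e\in E_H$ create a vertex $e^*$; for every edge $e=\{u,v\}\in E_H$ create (i) a path with $x_1$ edges (with new internal vertices) connecting $u^*$ to $e^*$, (ii) another such path with $x_1$ edges connecting $v^*$ to $e^*$, and (iii) a cycle $C(e)$ with $x_2$ edges (with new vertices other than $e^*$) passing through $e^*$. If $H$ contains an independent set of size $k$, then $\mathrm{disp}_{a/b}(G)\ge k+(2y_1+y_2)|E_H|$.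
   Context: All graphs are finite and undirected, and every edge is regarded as a rectifiable curve of length $1$. For a graph $G=(V,E)$, $P(G)$ denotes the set of all points on all edges (interior points) together with all vertices. For $p,q\in P(G)$, $d(p,q)$ is the length of a shortest path between $p$ and $q$ in this metric space. For a real $\delta>0$, a set $S\subset P(G)$ is $\delta$-dispersed if $d(p,q)\ge\delta$ for all distinct $p,q\in S$. The $\delta$-dispersion number $\mathrm{disp}_\delta(G)$ is the maximum cardinality of a $\delta$-dispersed subset of $P(G)$. -}

module Defs where

open import Data.Nat as ℕ using (ℕ; zero; suc; _∸_; _<?_)
open import Data.Fin using (Fin; toℕ; fromℕ<)
open import Data.Integer using (+_)
open import Data.Rational using (ℚ; _/_; _+_; _-_; _≤_; _<_; ∣_∣; 0ℚ; 1ℚ)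
open import Data.Product using (Σ; _×_; _,_; proj₁; proj₂; ∃)
open import Data.Sum using (_⊎_)
open import Data.List using (List; length)
open import Data.List.Membership.Propositional using (_∈_)
open import Data.List.Relation.Unary.All using (All)
open import Data.List.Relation.Unary.AllPairs using (AllPairs)
open import Data.List.Relation.Unary.Unique.Propositional using (Unique)
open import Relation.Binary.PropositionalEquality using (_≡_; _≢_)
open import Relation.Nullary using (¬_; yes; no)
open import Function.Definitions using (Injective)

-- (Multi)graphs: a set of vertices, a set of edges, and the two ends of
-- each edge.  Loops and parallel edges are allowed (needed for G, whose
-- cycles C(e) may have 1 or 2 edges).

record Graph : Set₁ where
  field
    V    : Set
    E    : Set
    ends : E → V × V
open Graph public

module _ (G : Graph) where

  Joins : E G → V G → V G → Set
  Joins e u v = ends G e ≡ (u , v) ⊎ ends G e ≡ (v , u)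

  Adj : V G → V G → Set
  Adj u v = ∃ λ e → Joins e u v

  data Walk : V G → V G → ℕ → Set where
    nil  : ∀ {u} → Walk u u 0
    step : ∀ {u v w n} (e : E G) → Joins e u v → Walk v w n → Walk u w (suc n)

  Connected : Set
  Connected = ∀ u w → ∃ λ n → Walk u w n

  Simple : Set
  Simple = (∀ e → proj₁ (ends G e) ≢ proj₂ (ends G e))
         × (∀ e f u v → Joins e u v → Joins f u v → e ≡ f)

  ThreeNeighbours : V G → Set
  ThreeNeighbours v = Σ (Fin 3 → V G) λ f →
    Injective _≡_ _≡_ f × (∀ i → Adj v (f i)) × (∀ w → Adj v w → ∃ λ i → f i ≡ w)

  Cubic : Set
  Cubic = ∀ v → ThreeNeighbours v

  HasIndependentSet : ℕ → Set
  HasIndependentSet k = Σ (List (V G)) λ I →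
    length I ≡ k × Unique I × AllPairs (λ u w → ¬ Adj u w) I

  -- Points of the metric graph P(G): vertices, and interior points of
  -- edges; (inner e t) is the point on e at distance t from the first end
  -- (proj₁ (ends G e)).  Positions are rational.

  data Point : Set where
    vtx   : V G → Point
    inner : E G → ℚ → Point

  ValidPoint : Point → Set
  ValidPoint (vtx v)     = Data.Unit.⊤ where import Data.Unit
  ValidPoint (inner e t) = (0ℚ < t) × (t < 1ℚ)

  ℕ→ℚ : ℕ → ℚ
  ℕ→ℚ n = + n / 1

  data Exit : Point → V G → ℚ → Set where
    atVtx : ∀ {v} → Exit (vtx v) v 0ℚ
    left  : ∀ {e t} → Exit (inner e t) (proj₁ (ends G e)) t
    right : ∀ {e t} → Exit (inner e t) (proj₂ (ends G e)) (1ℚ - t)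

  -- δ ≤ d(p,q), where d is the shortest-path metric: every path from p
  -- to q either stays inside a common edge, or leaves p through an end u
  -- of its edge, walks in G from u to an end w of q's edge, and enters q.
  AtLeastApart : ℚ → Point → Point → Set
  AtLeastApart δ p q =
    (∀ {u w c c' n} → Exit p u c → Exit q w c' → Walk u w n →
        δ ≤ (c + ℕ→ℚ n) + c')
    × (∀ {e t s} → p ≡ inner e t → q ≡ inner e s → δ ≤ ∣ t - s ∣)

  Dispersed : ℚ → List Point → Set
  Dispersed δ S = All ValidPoint S × Unique S × AllPairs (AtLeastApart δ) S

  DispAtLeast : ℚ → ℕ → Set
  DispAtLeast δ N = Σ (List Point) λ S → Dispersed δ S × N ℕ.≤ length S

-- Sequence of nodes of a path with len edges: node 0 = start,
-- node len = finish, node i (0 < i < len) = mid (i - 1).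

seqNode : {A : Set} (len : ℕ) → A → A → (Fin (len ∸ 1) → A) → ℕ → A
seqNode len start finish mid zero = start
seqNode len start finish mid (suc j) with j <? (len ∸ 1)
... | yes p = mid (fromℕ< p)
... | no _  = finish

module Construction (n m x₁ x₂ : ℕ) (endsH : Fin m → Fin n × Fin n) where

  data GV : Set where
    vstar : Fin n → GV
    estar : Fin m → GV
    pathU : Fin m → Fin (x₁ ∸ 1) → GV
    pathV : Fin m → Fin (x₁ ∸ 1) → GV
    cyc   : Fin m → Fin (x₂ ∸ 1) → GV

  data GE : Set where
    eU : Fin m → Fin x₁ → GE
    eV : Fin m → Fin x₁ → GE
    eC : Fin m → Fin x₂ → GE

  endsG : GE → GV × GV
  endsG (eU e j) = let nd = seqNode x₁ (vstar (proj₁ (endsH e))) (estar e) (pathU e)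
                   in nd (toℕ j) , nd (suc (toℕ j))
  endsG (eV e j) = let nd = seqNode x₁ (vstar (proj₂ (endsH e))) (estar e) (pathV e)
                   in nd (toℕ j) , nd (suc (toℕ j))
  endsG (eC e j) = let nd = seqNode x₂ (estar e) (estar e) (cyc e)
                   in nd (toℕ j) , nd (suc (toℕ j))

  G : Graph
  G = record { V = GV ; E = GE ; ends = endsG }

HGraph : (n m : ℕ) → (Fin m → Fin n × Fin n) → Graph
HGraph n m endsH = record { V = Fin n ; E = Fin m ; ends = endsH }

buildG : (n m x₁ x₂ : ℕ) → (Fin m → Fin n × Fin n) → Graph
buildG n m x₁ x₂ endsH = Construction.G n m x₁ x₂ endsH

module Submission where

-- Write a = 2h + 1 and measure lengths in units of 1 / b: each path of a gadget has length
-- a y₁ + h and each cycle a y₂ + 1.  Besides the stars v* with v ∈ I, take y₁ points on each path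
-- and y₂ on each cycle, consecutive ones a apart.  On the path towards an endpoint in I (there is at
-- most one, I being independent) they start a away from that star, on the other path 2h away, and
-- on the cycle h + 1 away from e*.  The last ones then lie h, h + 1 and h + 1 away from e*, so points
-- on different arms of a gadget are at least 2h + 1 = a apart, and points of two gadgets meeting at
-- a star outside I are at least 2h + 2h ≥ a apart.  Each such bound is witnessed by a function on
-- P(G) that is 1-Lipschitz along every edge, vanishes at one point and is at least a at the other:
-- the distance from that point inside its gadget, continued from the stars into the other gadgets
-- and capped at a.

open import Data.Nat using (ℕ; suc; _*_; _≤_)
open import Data.Fin using (Fin)
open import Data.Product using (_×_; proj₁; proj₂)
open import Data.Empty using (⊥)
open import Data.List using (List)
open import Data.List.Relation.Unary.AllPairs using (AllPairs)
open import Data.List.Relation.Unary.Unique.Propositional using (Unique)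
open import Relation.Binary.PropositionalEquality using (_≡_; _≢_)
open import Relation.Nullary using (¬_)
open import Relation.Unary using (Decidable)
open import Defs

module NonExpandingMaps where

  open import Data.Nat using (ℕ; _+_; _∸_; _≤_; ∣_-_∣; _⊓_)
  open import Data.Nat.Properties
  open import Relation.Binary.PropositionalEquality using (sym; cong; subst)

  NonExpanding : (ℕ → ℕ) → Set
  NonExpanding f = ∀ x y → f x ≤ f y + ∣ x - y ∣

  const-nonExpanding : ∀ k → NonExpanding (λ _ → k)
  const-nonExpanding k x y = m≤m+n k _

  id-nonExpanding : NonExpanding (λ x → x)
  id-nonExpanding = m≤n+∣m-n∣

  ∣-∣-nonExpanding : ∀ σ → NonExpanding (λ x → ∣ σ - x ∣)
  ∣-∣-nonExpanding σ x y = subst (λ d → ∣ σ - x ∣ ≤ ∣ σ - y ∣ + d) (∣-∣-comm y x) (∣-∣-triangle σ y x)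

  +-nonExpanding : ∀ k {f} → NonExpanding f → NonExpanding (λ x → k + f x)
  +-nonExpanding k {f} f-ne x y = subst (k + f x ≤_) (sym (+-assoc k (f y) _)) (+-monoʳ-≤ k (f-ne x y))

  ∸-nonExpanding : ∀ k {f} → NonExpanding f → NonExpanding (λ x → k ∸ f x)
  ∸-nonExpanding k {f} f-ne x y = m≤n+o⇒m∸n≤o k (f x) (begin
      k                             ≤⟨ m≤n+m∸n k (f y) ⟩
      f y + (k ∸ f y)               ≤⟨ +-monoˡ-≤ (k ∸ f y) (f-ne y x) ⟩
      f x + ∣ y - x ∣ + (k ∸ f y)   ≡⟨ cong (λ d → f x + d + (k ∸ f y)) (∣-∣-comm y x) ⟩
      f x + ∣ x - y ∣ + (k ∸ f y)   ≡⟨ +-assoc (f x) _ _ ⟩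
      f x + (∣ x - y ∣ + (k ∸ f y)) ≡⟨ cong (f x +_) (+-comm ∣ x - y ∣ (k ∸ f y)) ⟩
      f x + (k ∸ f y + ∣ x - y ∣)   ∎)
    where open ≤-Reasoning

  ⊓-nonExpanding : ∀ {f g} → NonExpanding f → NonExpanding g → NonExpanding (λ x → f x ⊓ g x)
  ⊓-nonExpanding {f} {g} f-ne g-ne x y = subst (f x ⊓ g x ≤_) (sym (+-distribʳ-⊓ ∣ x - y ∣ (f y) (g y)))
    (⊓-glb (≤-trans (m⊓n≤m (f x) (g x)) (f-ne x y)) (≤-trans (m⊓n≤n (f x) (g x)) (g-ne x y)))

module Scaled (b-1 : ℕ) where

  open import Data.Nat as ℕ using (ℕ; suc; _≤_; _<_)
  import Data.Nat.Properties as ℕ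
  open import Data.Integer as ℤ using (ℤ; +_; _⊖_)
  import Data.Integer.Properties as ℤ
  open import Data.Integer.Tactic.RingSolver using (solve-∀)
  open import Data.Rational using (ℚ; _/_; _+_; _-_; -_; ∣_∣; 0ℚ; 1ℚ; toℚᵘ)
    renaming (_≤_ to _≤ℚ_; _<_ to _<ℚ_)
  open import Data.Rational.Properties
    using (toℚᵘ-injective; toℚᵘ-fromℚᵘ; toℚᵘ-homo-+; toℚᵘ-homo‿-; toℚᵘ-homo-∣-∣; toℚᵘ-cancel-≤; toℚᵘ-cancel-<)
  open import Data.Rational.Unnormalised as ℚᵘ using (ℚᵘ; mkℚᵘ; _≃_; *≡*; *≤*; *<*)
  import Data.Rational.Unnormalised.Properties as ℚᵘ
  open import Data.Sum using (inj₁; inj₂)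
  open import Relation.Binary.PropositionalEquality

  b : ℕ
  b = suc b-1

  ⟦_⟧ : ℤ → ℚ
  ⟦ i ⟧ = i / b

  private
    ⟦_⟧ᵘ : ℤ → ℚᵘ
    ⟦ i ⟧ᵘ = mkℚᵘ i b-1

    toℚᵘ-⟦⟧ : ∀ i → toℚᵘ ⟦ i ⟧ ≃ ⟦ i ⟧ᵘ
    toℚᵘ-⟦⟧ i = toℚᵘ-fromℚᵘ ⟦ i ⟧ᵘ

    ⟦⟧-≡ : ∀ {p} i → toℚᵘ p ≃ ⟦ i ⟧ᵘ → p ≡ ⟦ i ⟧
    ⟦⟧-≡ i eq = toℚᵘ-injective (ℚᵘ.≃-trans eq (ℚᵘ.≃-sym (toℚᵘ-⟦⟧ i)))

    ⟦⟧ᵘ-+ : ∀ i j → ⟦ i ⟧ᵘ ℚᵘ.+ ⟦ j ⟧ᵘ ≃ ⟦ i ℤ.+ j ⟧ᵘ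
    ⟦⟧ᵘ-+ i j = *≡* (begin
        (i ℤ.* + b ℤ.+ j ℤ.* + b) ℤ.* + b  ≡⟨ distrib i j (+ b) ⟩
        (i ℤ.+ j) ℤ.* (+ b ℤ.* + b)         ≡⟨ cong ((i ℤ.+ j) ℤ.*_) (ℤ.pos-* b b) ⟨
        (i ℤ.+ j) ℤ.* + (b ℕ.* b)           ∎)
      where
      open ≡-Reasoning
      distrib : ∀ i j k → (i ℤ.* k ℤ.+ j ℤ.* k) ℤ.* k ≡ (i ℤ.+ j) ℤ.* (k ℤ.* k)
      distrib = solve-∀

  ⟦⟧-+ : ∀ i j → ⟦ i ⟧ + ⟦ j ⟧ ≡ ⟦ i ℤ.+ j ⟧
  ⟦⟧-+ i j = ⟦⟧-≡ (i ℤ.+ j)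
    (ℚᵘ.≃-trans (toℚᵘ-homo-+ ⟦ i ⟧ ⟦ j ⟧) (ℚᵘ.≃-trans (ℚᵘ.+-cong (toℚᵘ-⟦⟧ i) (toℚᵘ-⟦⟧ j)) (⟦⟧ᵘ-+ i j)))

  ⟦⟧-neg : ∀ i → - ⟦ i ⟧ ≡ ⟦ ℤ.- i ⟧
  ⟦⟧-neg i = ⟦⟧-≡ (ℤ.- i) (ℚᵘ.≃-trans (toℚᵘ-homo‿- ⟦ i ⟧) (ℚᵘ.-‿cong (toℚᵘ-⟦⟧ i)))

  ⟦⟧-∣∣ : ∀ i → ∣ ⟦ i ⟧ ∣ ≡ ⟦ + ℤ.∣ i ∣ ⟧
  ⟦⟧-∣∣ i = ⟦⟧-≡ (+ ℤ.∣ i ∣) (ℚᵘ.≃-trans (toℚᵘ-homo-∣-∣ ⟦ i ⟧) (ℚᵘ.∣-∣-cong (toℚᵘ-⟦⟧ i)))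

  ⟦⟧-mono-≤ : ∀ {i j} → i ℤ.≤ j → ⟦ i ⟧ ≤ℚ ⟦ j ⟧
  ⟦⟧-mono-≤ {i} {j} i≤j = toℚᵘ-cancel-≤
    (ℚᵘ.≤-respˡ-≃ (ℚᵘ.≃-sym (toℚᵘ-⟦⟧ i))
      (ℚᵘ.≤-respʳ-≃ (ℚᵘ.≃-sym (toℚᵘ-⟦⟧ j)) (*≤* (ℤ.*-monoʳ-≤-nonNeg (+ b) i≤j))))

  ⟦⟧-mono-< : ∀ {i j} → i ℤ.< j → ⟦ i ⟧ <ℚ ⟦ j ⟧
  ⟦⟧-mono-< {i} {j} i<j = toℚᵘ-cancel-<
    (ℚᵘ.<-respˡ-≃ (ℚᵘ.≃-sym (toℚᵘ-⟦⟧ i))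
      (ℚᵘ.<-respʳ-≃ (ℚᵘ.≃-sym (toℚᵘ-⟦⟧ j)) (*<* (ℤ.*-monoʳ-<-pos (+ b) i<j))))

  0ℚ≡⟦0⟧ : 0ℚ ≡ ⟦ + 0 ⟧
  0ℚ≡⟦0⟧ = ⟦⟧-≡ (+ 0) (*≡* refl)

  1ℚ≡⟦b⟧ : 1ℚ ≡ ⟦ + b ⟧
  1ℚ≡⟦b⟧ = ⟦⟧-≡ (+ b) (*≡* (ℤ.*-comm (+ 1) (+ b)))

  n/1≡⟦n*b⟧ : ∀ n → + n / 1 ≡ ⟦ + (n ℕ.* b) ⟧
  n/1≡⟦n*b⟧ n = ⟦⟧-≡ (+ (n ℕ.* b)) (ℚᵘ.≃-trans (toℚᵘ-fromℚᵘ (mkℚᵘ (+ n) 0))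
    (*≡* (trans (sym (ℤ.pos-* n b)) (sym (ℤ.*-identityʳ (+ (n ℕ.* b)))))))

  ⟦m⟧-⟦n⟧≡⟦m⊖n⟧ : ∀ m n → ⟦ + m ⟧ - ⟦ + n ⟧ ≡ ⟦ m ⊖ n ⟧
  ⟦m⟧-⟦n⟧≡⟦m⊖n⟧ m n =
    trans (cong (λ q → ⟦ + m ⟧ + q) (⟦⟧-neg (+ n))) (trans (⟦⟧-+ (+ m) (ℤ.- + n)) (cong ⟦_⟧ (ℤ.m-n≡m⊖n m n)))

  ∣m⊖n∣≡∣m-n∣ : ∀ m n → ℤ.∣ m ⊖ n ∣ ≡ ℕ.∣ m - n ∣
  ∣m⊖n∣≡∣m-n∣ m n with ℕ.≤-total n m
  ... | inj₁ n≤m = trans (cong ℤ.∣_∣ (ℤ.⊖-≥ n≤m)) (sym (ℕ.m≤n⇒∣n-m∣≡n∸m n≤m))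
  ... | inj₂ m≤n = trans (ℤ.∣m⊖n∣≡∣n⊖m∣ m n) (trans (cong ℤ.∣_∣ (ℤ.⊖-≥ m≤n)) (sym (ℕ.m≤n⇒∣m-n∣≡n∸m m≤n)))

  ∣⟦m⟧-⟦n⟧∣≡⟦∣m-n∣⟧ : ∀ m n → ∣ ⟦ + m ⟧ - ⟦ + n ⟧ ∣ ≡ ⟦ + ℕ.∣ m - n ∣ ⟧
  ∣⟦m⟧-⟦n⟧∣≡⟦∣m-n∣⟧ m n =
    trans (cong ∣_∣ (⟦m⟧-⟦n⟧≡⟦m⊖n⟧ m n)) (trans (⟦⟧-∣∣ (m ⊖ n)) (cong (λ k → ⟦ + k ⟧) (∣m⊖n∣≡∣m-n∣ m n)))

  1-⟦r⟧≡⟦b∸r⟧ : ∀ {r} → r ≤ b → 1ℚ - ⟦ + r ⟧ ≡ ⟦ + (b ℕ.∸ r) ⟧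
  1-⟦r⟧≡⟦b∸r⟧ {r} r≤b = trans (cong (_- ⟦ + r ⟧) 1ℚ≡⟦b⟧) (trans (⟦m⟧-⟦n⟧≡⟦m⊖n⟧ b r) (cong ⟦_⟧ (ℤ.⊖-≥ r≤b)))

  ⟦x⟧+n+⟦y⟧≡⟦x+nb+y⟧ : ∀ x n y → (⟦ + x ⟧ + + n / 1) + ⟦ + y ⟧ ≡ ⟦ + (x ℕ.+ n ℕ.* b ℕ.+ y) ⟧
  ⟦x⟧+n+⟦y⟧≡⟦x+nb+y⟧ x n y = begin
    (⟦ + x ⟧ + + n / 1) + ⟦ + y ⟧              ≡⟨ cong (λ q → (⟦ + x ⟧ + q) + ⟦ + y ⟧) (n/1≡⟦n*b⟧ n) ⟩
    (⟦ + x ⟧ + ⟦ + (n ℕ.* b) ⟧) + ⟦ + y ⟧      ≡⟨ cong (_+ ⟦ + y ⟧) (⟦⟧-+ (+ x) (+ (n ℕ.* b))) ⟩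
    ⟦ + (x ℕ.+ n ℕ.* b) ⟧ + ⟦ + y ⟧            ≡⟨ ⟦⟧-+ (+ (x ℕ.+ n ℕ.* b)) (+ y) ⟩
    ⟦ + (x ℕ.+ n ℕ.* b ℕ.+ y) ⟧                ∎
    where open ≡-Reasoning

  0<⟦⟧ : ∀ {r} → 0 < r → 0ℚ <ℚ ⟦ + r ⟧
  0<⟦⟧ {r} 0<r = subst (_<ℚ ⟦ + r ⟧) (sym 0ℚ≡⟦0⟧) (⟦⟧-mono-< (ℤ.+<+ 0<r))

  ⟦⟧<1 : ∀ {r} → r < b → ⟦ + r ⟧ <ℚ 1ℚ
  ⟦⟧<1 {r} r<b = subst (⟦ + r ⟧ <ℚ_) (sym 1ℚ≡⟦b⟧) (⟦⟧-mono-< (ℤ.+<+ r<b))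

module Apartness where

  open import Data.Rational using (ℚ; 0ℚ; _<_)
  open import Data.Rational.Properties using (<-irrefl; <-≤-trans; +-inverseʳ)
  open import Data.List.Relation.Unary.AllPairs as AllPairs using (AllPairs)
  open import Data.List.Relation.Unary.Unique.Propositional using (Unique)
  open import Relation.Binary.PropositionalEquality using (refl; sym; subst; cong)
  import Data.Rational as ℚ

  module _ (G : Graph) {δ : ℚ} (δ>0 : 0ℚ < δ) where

    ¬AtLeastApart-refl : ∀ p → ¬ AtLeastApart G δ p p
    ¬AtLeastApart-refl (vtx v)     apart = <-irrefl refl (<-≤-trans δ>0 (proj₁ apart atVtx atVtx nil))
    ¬AtLeastApart-refl (inner e t) apart =
      <-irrefl refl (<-≤-trans δ>0 (subst (δ ℚ.≤_) (cong ℚ.∣_∣ (+-inverseʳ t)) (proj₂ apart refl refl)))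

    apart⇒unique : ∀ {S} → AllPairs (AtLeastApart G δ) S → Unique S
    apart⇒unique = AllPairs.map λ {p} apart p≡q → ¬AtLeastApart-refl p (subst (AtLeastApart G δ p) (sym p≡q) apart)

module Potentials (b-1 x₁ x₂ n m : ℕ) (endsH : Fin m → Fin n × Fin n) where

  open NonExpandingMaps
  open Scaled b-1
  open import Data.Nat as ℕ using (zero; suc; _+_; _*_; _∸_; _≤_; _<_; s≤s; _≟_; _<?_; ∣_-_∣; _/_; _%_)
  open import Data.Nat.Properties
  open import Data.Nat.DivMod using (m≡m%n+[m/n]*n; m%n≡m∸m/n*n; m/n*n≤m; m<n*o⇒m/o<n; m%n<n; m%n≤n)
  open import Data.Fin using (toℕ; fromℕ<)
  open import Data.Fin.Properties using (toℕ-fromℕ<; toℕ<n)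
  open import Data.Product using (Σ; _,_; proj₁; proj₂)
  open import Data.Sum using (inj₁; inj₂)
  open import Data.Unit using (⊤; tt)
  open import Data.Empty using (⊥-elim)
  open import Data.Integer using (+_; +≤+)
  import Data.Rational as ℚ
  open import Relation.Binary.PropositionalEquality
  open import Relation.Nullary using (yes; no)

  open Construction n m x₁ x₂ endsH

  seqNode-agrees : {A B : Set} (f : A → B) (g : ℕ → B) (len : ℕ) {s t : A} {mid : Fin (len ∸ 1) → A} →
                   f s ≡ g 0 → f t ≡ g len → (∀ k → f (mid k) ≡ g (suc (toℕ k))) →
                   ∀ i → i ≤ len → f (seqNode len s t mid i) ≡ g i
  seqNode-agrees f g zero    f-s f-t f-mid (suc j) ()
  seqNode-agrees f g len     f-s f-t f-mid zero    _ = f-s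
  seqNode-agrees f g (suc l) f-s f-t f-mid (suc j) (s≤s j≤l) with j <? l
  ... | yes j<l = trans (f-mid (fromℕ< j<l)) (cong (λ k → g (suc k)) (toℕ-fromℕ< j<l))
  ... | no  j≮l = trans f-t (cong (λ k → g (suc k)) (≤-antisym (≮⇒≥ j≮l) j≤l))

  data Arm : Set where
    armU armV armC : Arm

  edges : Arm → ℕ
  edges armU = x₁
  edges armV = x₁
  edges armC = x₂

  node : Fin m → Arm → ℕ → GV
  node e armU = seqNode x₁ (vstar (proj₁ (endsH e))) (estar e) (pathU e)
  node e armV = seqNode x₁ (vstar (proj₂ (endsH e))) (estar e) (pathV e)
  node e armC = seqNode x₂ (estar e) (estar e) (cyc e)

  arc : (e : Fin m) (B : Arm) → Fin (edges B) → GE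
  arc e armU = eU e
  arc e armV = eV e
  arc e armC = eC e

  ends-arc : ∀ e B j → endsG (arc e B j) ≡ (node e B (toℕ j) , node e B (suc (toℕ j)))
  ends-arc e armU j = refl
  ends-arc e armV j = refl
  ends-arc e armC j = refl

  arc-injective : ∀ {e e′ B B′ j j′} → arc e B j ≡ arc e′ B′ j′ →
                  e ≡ e′ × B ≡ B′ × toℕ j ≡ toℕ j′
  arc-injective {B = armU} {armU} refl = refl , refl , refl
  arc-injective {B = armV} {armV} refl = refl , refl , refl
  arc-injective {B = armC} {armC} refl = refl , refl , refl
  arc-injective {B = armU} {armV} ()
  arc-injective {B = armU} {armC} ()
  arc-injective {B = armV} {armU} ()
  arc-injective {B = armV} {armC} ()
  arc-injective {B = armC} {armU} ()
  arc-injective {B = armC} {armV} ()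

  -- (onArm e B σ) lies at distance σ / b from the start of arm B of the gadget of e.
  data Place : Set where
    star  : Fin n → Place
    onArm : Fin m → Arm → ℕ → Place

  InRange : Place → Set
  InRange (star _)      = ⊤
  InRange (onArm e B σ) = σ < edges B * b

  -- Out of range, the position is junk and sent to e*.
  point : Place → Point G
  point (star v) = vtx (vstar v)
  point (onArm e B σ) with σ % b ≟ 0 | σ / b <? edges B
  ... | yes _ | _        = vtx (node e B (σ / b))
  ... | no _  | yes σ<len = inner (arc e B (fromℕ< σ<len)) ⟦ + (σ % b) ⟧
  ... | no _  | no _     = vtx (estar e)

  point-valid : ∀ p → ValidPoint G (point p)
  point-valid (star v) = tt
  point-valid (onArm e B σ) with σ % b ≟ 0 | σ / b <? edges B
  ... | yes _    | _     = tt
  ... | no σ%b≢0 | yes _ = 0<⟦⟧ (n≢0⇒n>0 σ%b≢0) , ⟦⟧<1 (m%n<n σ b)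
  ... | no _     | no _  = tt

  ∣σ-⌊σ⌋∣≡σ%b : ∀ σ → ∣ σ - σ / b * b ∣ ≡ σ % b
  ∣σ-⌊σ⌋∣≡σ%b σ = trans (m≤n⇒∣n-m∣≡n∸m (m/n*n≤m σ b)) (sym (m%n≡m∸m/n*n σ b))

  ∣σ-⌈σ⌉∣≡b∸σ%b : ∀ σ → ∣ σ - suc (σ / b) * b ∣ ≡ b ∸ σ % b
  ∣σ-⌈σ⌉∣≡b∸σ%b σ = begin
    ∣ σ - b + σ / b * b ∣                       ≡⟨ cong (λ s → ∣ s - b + σ / b * b ∣) (m≡m%n+[m/n]*n σ b) ⟩
    ∣ σ % b + σ / b * b - b + σ / b * b ∣       ≡⟨ cong₂ ∣_-_∣ (+-comm (σ % b) _) (+-comm b _) ⟩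
    ∣ σ / b * b + σ % b - σ / b * b + b ∣       ≡⟨ ∣m+n-m+o∣≡∣n-o∣ (σ / b * b) (σ % b) b ⟩
    ∣ σ % b - b ∣                               ≡⟨ m≤n⇒∣m-n∣≡n∸m (m%n≤n σ b) ⟩
    b ∸ σ % b                                   ∎
    where open ≡-Reasoning

  ∣σ-σ′∣≡∣σ%b-σ′%b∣ : ∀ σ σ′ → σ / b ≡ σ′ / b → ∣ σ - σ′ ∣ ≡ ∣ σ % b - σ′ % b ∣
  ∣σ-σ′∣≡∣σ%b-σ′%b∣ σ σ′ same-quotient = begin
    ∣ σ - σ′ ∣                                   ≡⟨ cong₂ ∣_-_∣ (m≡m%n+[m/n]*n σ b) (m≡m%n+[m/n]*n σ′ b) ⟩
    ∣ σ % b + σ / b * b - σ′ % b + σ′ / b * b ∣   ≡⟨ cong (λ q → ∣ σ % b + σ / b * b - σ′ % b + q * b ∣) (sym same-quotient) ⟩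
    ∣ σ % b + σ / b * b - σ′ % b + σ / b * b ∣    ≡⟨ cong₂ ∣_-_∣ (+-comm (σ % b) _) (+-comm (σ′ % b) _) ⟩
    ∣ σ / b * b + σ % b - σ / b * b + σ′ % b ∣    ≡⟨ ∣m+n-m+o∣≡∣n-o∣ (σ / b * b) _ _ ⟩
    ∣ σ % b - σ′ % b ∣                            ∎
    where open ≡-Reasoning

  exit-onArm : ∀ e B σ {w c} → σ < edges B * b → Exit G (point (onArm e B σ)) w c →
               Σ ℕ λ i → i ≤ edges B × w ≡ node e B i × c ≡ ⟦ + ∣ σ - i * b ∣ ⟧
  exit-onArm e B σ σ<len exit with σ % b ≟ 0 | σ / b <? edges B
  exit-onArm e B σ σ<len atVtx | yes σ%b≡0 | _ =
    σ / b , <⇒≤ (m<n*o⇒m/o<n σ<len) , refl ,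
    trans 0ℚ≡⟦0⟧ (cong (λ k → ⟦ + k ⟧) (sym (trans (∣σ-⌊σ⌋∣≡σ%b σ) σ%b≡0)))
  exit-onArm e B σ σ<len left  | no _ | yes q<len =
    σ / b , <⇒≤ q<len ,
    trans (cong proj₁ (ends-arc e B (fromℕ< q<len))) (cong (node e B) (toℕ-fromℕ< q<len)) ,
    cong (λ k → ⟦ + k ⟧) (sym (∣σ-⌊σ⌋∣≡σ%b σ))
  exit-onArm e B σ σ<len right | no _ | yes q<len =
    suc (σ / b) , q<len ,
    trans (cong proj₂ (ends-arc e B (fromℕ< q<len))) (cong (λ k → node e B (suc k)) (toℕ-fromℕ< q<len)) ,
    trans (1-⟦r⟧≡⟦b∸r⟧ (m%n≤n σ b)) (cong (λ k → ⟦ + k ⟧) (sym (∣σ-⌈σ⌉∣≡b∸σ%b σ)))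
  ... | no _ | no q≮len = ⊥-elim (q≮len (m<n*o⇒m/o<n σ<len))

  inner-onArm : ∀ e B σ {ε t} → point (onArm e B σ) ≡ inner ε t →
                Σ (Fin (edges B)) λ j → ε ≡ arc e B j × toℕ j ≡ σ / b × t ≡ ⟦ + (σ % b) ⟧
  inner-onArm e B σ eq with σ % b ≟ 0 | σ / b <? edges B
  inner-onArm e B σ () | yes _ | _
  inner-onArm e B σ refl | no _ | yes q<len = fromℕ< q<len , refl , toℕ-fromℕ< q<len , refl
  inner-onArm e B σ () | no _ | no _

  -- A function on P(G), measured in units of 1 / b, that is 1-Lipschitz along every arm.
  record Potential : Set where
    field
      atStar : Fin n → ℕ
      along  : Fin m → Arm → ℕ → ℕ
      startU : ∀ e → atStar (proj₁ (endsH e)) ≡ along e armU 0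
      startV : ∀ e → atStar (proj₂ (endsH e)) ≡ along e armV 0
      endU   : ∀ e → along e armU (x₁ * b) ≡ along e armC 0
      endV   : ∀ e → along e armV (x₁ * b) ≡ along e armC 0
      endC   : ∀ e → along e armC (x₂ * b) ≡ along e armC 0
      along-nonExpanding : ∀ e B → NonExpanding (along e B)

  module _ (P : Potential) where
    open Potential P

    valueAt : Place → ℕ
    valueAt (star v)      = atStar v
    valueAt (onArm e B σ) = along e B σ

    atVertex : GV → ℕ
    atVertex (vstar v)   = atStar v
    atVertex (estar e)   = along e armC 0
    atVertex (pathU e k) = along e armU (suc (toℕ k) * b)
    atVertex (pathV e k) = along e armV (suc (toℕ k) * b)
    atVertex (cyc e k)   = along e armC (suc (toℕ k) * b)

    atVertex-node : ∀ e B i → i ≤ edges B → atVertex (node e B i) ≡ along e B (i * b)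
    atVertex-node e armU = seqNode-agrees atVertex (λ i → along e armU (i * b)) x₁ (startU e) (sym (endU e)) (λ _ → refl)
    atVertex-node e armV = seqNode-agrees atVertex (λ i → along e armV (i * b)) x₁ (startV e) (sym (endV e)) (λ _ → refl)
    atVertex-node e armC = seqNode-agrees atVertex (λ i → along e armC (i * b)) x₂ refl (sym (endC e)) (λ _ → refl)

    ∣[1+i]b-ib∣≡b : ∀ i → ∣ suc i * b - i * b ∣ ≡ b
    ∣[1+i]b-ib∣≡b i = trans (cong (λ x → ∣ x - i * b ∣) (+-comm b (i * b)))
                            (trans (∣-∣-comm (i * b + b) (i * b)) (∣m-m+n∣≡n (i * b) b))

    atVertex-step : ∀ e B (j : Fin (edges B)) → atVertex (node e B (suc (toℕ j))) ≤ atVertex (node e B (toℕ j)) + b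
                                               × atVertex (node e B (toℕ j)) ≤ atVertex (node e B (suc (toℕ j))) + b
    atVertex-step e B j rewrite atVertex-node e B (toℕ j) (<⇒≤ (toℕ<n j)) | atVertex-node e B (suc (toℕ j)) (toℕ<n j) =
      subst (λ d → along e B (suc i * b) ≤ along e B (i * b) + d) (∣[1+i]b-ib∣≡b i) (along-nonExpanding e B _ _) ,
      subst (λ d → along e B (i * b) ≤ along e B (suc i * b) + d) (trans (∣-∣-comm (i * b) _) (∣[1+i]b-ib∣≡b i))
            (along-nonExpanding e B _ _)
      where i = toℕ j

    atVertex-joins : ∀ {ε u v} → Joins G ε u v → atVertex v ≤ atVertex u + b
    atVertex-joins {eU e j} (inj₁ refl) = proj₁ (atVertex-step e armU j)
    atVertex-joins {eV e j} (inj₁ refl) = proj₁ (atVertex-step e armV j)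
    atVertex-joins {eC e j} (inj₁ refl) = proj₁ (atVertex-step e armC j)
    atVertex-joins {eU e j} (inj₂ refl) = proj₂ (atVertex-step e armU j)
    atVertex-joins {eV e j} (inj₂ refl) = proj₂ (atVertex-step e armV j)
    atVertex-joins {eC e j} (inj₂ refl) = proj₂ (atVertex-step e armC j)

    atVertex-walk : ∀ {u w k} → Walk G u w k → atVertex w ≤ atVertex u + k * b
    atVertex-walk nil = m≤m+n _ 0
    atVertex-walk {u} {w} {suc k} (step {v = v} ε joins walk) = begin
      atVertex w                  ≤⟨ atVertex-walk walk ⟩
      atVertex v + k * b          ≤⟨ +-monoˡ-≤ (k * b) (atVertex-joins joins) ⟩
      atVertex u + b + k * b      ≡⟨ +-assoc (atVertex u) b (k * b) ⟩
      atVertex u + suc k * b      ∎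
      where open ≤-Reasoning

    exit-bound : ∀ p {u c} → InRange p → Exit G (point p) u c →
                 Σ ℕ λ d → c ≡ ⟦ + d ⟧ × atVertex u ≤ valueAt p + d × valueAt p ≤ atVertex u + d
    exit-bound (star v) tt atVtx = 0 , 0ℚ≡⟦0⟧ , m≤m+n _ 0 , m≤m+n _ 0
    exit-bound (onArm e B σ) σ<len exit with exit-onArm e B σ σ<len exit
    ... | i , i≤len , refl , refl rewrite atVertex-node e B i i≤len =
      ∣ σ - i * b ∣ , refl ,
      subst (λ d → along e B (i * b) ≤ along e B σ + d) (∣-∣-comm (i * b) σ) (along-nonExpanding e B _ _) ,
      along-nonExpanding e B _ _

    separation : ∀ {a p q} → InRange p → InRange q → valueAt p ≡ 0 → a ≤ valueAt q →
                 AtLeastApart G ⟦ + a ⟧ (point p) (point q)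
    separation {a} {p} {q} p-in q-in p↦0 a≤q = through-vertices , within-edge p q p↦0 a≤q
      where
      through-vertices : ∀ {u w c c′ k} → Exit G (point p) u c → Exit G (point q) w c′ → Walk G u w k →
                         ⟦ + a ⟧ ℚ.≤ (c ℚ.+ ℕ→ℚ G k) ℚ.+ c′
      through-vertices {u} {w} {k = k} exit exit′ walk with exit-bound p p-in exit | exit-bound q q-in exit′
      ... | d , refl , u≤p+d , _ | d′ , refl , _ , q≤w+d′ =
        subst (⟦ + a ⟧ ℚ.≤_) (sym (⟦x⟧+n+⟦y⟧≡⟦x+nb+y⟧ d k d′)) (⟦⟧-mono-≤ (+≤+ (begin
          a                           ≤⟨ a≤q ⟩
          valueAt q                   ≤⟨ q≤w+d′ ⟩
          atVertex w + d′             ≤⟨ +-monoˡ-≤ d′ (atVertex-walk walk) ⟩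
          atVertex u + k * b + d′     ≤⟨ +-monoˡ-≤ d′ (+-monoˡ-≤ (k * b) u≤p+d) ⟩
          valueAt p + d + k * b + d′  ≡⟨ cong (λ x → x + d + k * b + d′) p↦0 ⟩
          d + k * b + d′              ∎)))
        where open ≤-Reasoning
      within-edge : ∀ p q → valueAt p ≡ 0 → a ≤ valueAt q →
                    ∀ {ε t s} → point p ≡ inner ε t → point q ≡ inner ε s →
                    ⟦ + a ⟧ ℚ.≤ ℚ.∣ t ℚ.- s ∣
      within-edge (star v) _ _ _ ()
      within-edge (onArm e B σ) (star v) _ _ _ ()
      within-edge (onArm e B σ) (onArm e′ B′ σ′) σ↦0 a≤σ′ on-ε on-ε′ with inner-onArm e B σ on-ε
      ... | j , refl , j≡σ/b , refl with inner-onArm e′ B′ σ′ on-ε′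
      ... | j′ , same-arc , j′≡σ′/b , refl with arc-injective same-arc
      ... | refl , refl , j≡j′ =
        subst (⟦ + a ⟧ ℚ.≤_) (sym (∣⟦m⟧-⟦n⟧∣≡⟦∣m-n∣⟧ (σ % b) (σ′ % b))) (⟦⟧-mono-≤ (+≤+ (begin
          a                           ≤⟨ a≤σ′ ⟩
          along e B σ′                ≤⟨ along-nonExpanding e B σ′ σ ⟩
          along e B σ + ∣ σ′ - σ ∣     ≡⟨ cong₂ _+_ σ↦0 (∣-∣-comm σ′ σ) ⟩
          ∣ σ - σ′ ∣                  ≡⟨ ∣σ-σ′∣≡∣σ%b-σ′%b∣ σ σ′ (trans (sym j≡σ/b) (trans j≡j′ j′≡σ′/b)) ⟩
          ∣ σ % b - σ′ % b ∣          ∎)))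
        where open ≤-Reasoning

module Placement (h y₁ y₂ : ℕ) where

  open import Data.Nat using (suc; _+_; _*_; _∸_; _≤_; _<_; z≤n; s≤s; ∣_-_∣; _⊓_)
  open import Data.Nat.Properties
  open import Data.Nat.Tactic.RingSolver using (solve-∀)
  open import Relation.Binary.PropositionalEquality

  a L Cl : ℕ
  a  = suc (h + h)
  L  = a * y₁ + h
  Cl = a * y₂ + 1

  data Role : Set where
    head tail loop : Role

  offset : Role → ℕ
  offset head = a
  offset tail = h + h
  offset loop = suc h

  position : Role → ℕ → ℕ
  position r j = a * j + offset r

  open ≤-Reasoning

  a*j+a≤a*k : ∀ {j k} → j < k → a * j + a ≤ a * k
  a*j+a≤a*k {j} {k} j<k = begin
    a * j + a   ≡⟨ +-comm (a * j) a ⟩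
    a + a * j   ≡⟨ *-suc a j ⟨
    a * suc j   ≤⟨ *-monoʳ-≤ a j<k ⟩
    a * k       ∎

  offset≤a : ∀ r → offset r ≤ a
  offset≤a head = ≤-refl
  offset≤a tail = n≤1+n (h + h)
  offset≤a loop = s≤s (m≤m+n h h)

  position≤a*k : ∀ r {j k} → j < k → position r j ≤ a * k
  position≤a*k r {j} j<k = ≤-trans (+-monoʳ-≤ (a * j) (offset≤a r)) (a*j+a≤a*k j<k)

  a≤L : 1 ≤ y₁ → a ≤ L
  a≤L 1≤y₁ = begin
    a          ≡⟨ *-identityʳ a ⟨
    a * 1      ≤⟨ *-monoʳ-≤ a 1≤y₁ ⟩
    a * y₁     ≤⟨ m≤m+n (a * y₁) h ⟩
    L          ∎

  1≤position : 1 ≤ h → ∀ r j → 1 ≤ position r j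
  1≤position 1≤h head j = ≤-trans (s≤s z≤n) (m≤n+m a (a * j))
  1≤position 1≤h tail j = ≤-trans (≤-trans 1≤h (m≤m+n h h)) (m≤n+m (h + h) (a * j))
  1≤position 1≤h loop j = ≤-trans (s≤s z≤n) (m≤n+m (suc h) (a * j))

  a≤position-head : ∀ j → a ≤ position head j
  a≤position-head j = m≤n+m a (a * j)

  a≤1+position-tail : ∀ j → a ≤ suc (position tail j)
  a≤1+position-tail j = s≤s (m≤n+m (h + h) (a * j))

  ∣position-position∣ : ∀ r j j′ → ∣ position r j - position r j′ ∣ ≡ a * ∣ j - j′ ∣
  ∣position-position∣ r j j′ =
    trans (cong₂ ∣_-_∣ (+-comm (a * j) (offset r)) (+-comm (a * j′) (offset r)))
          (trans (∣m+n-m+o∣≡∣n-o∣ (offset r) (a * j) (a * j′)) (sym (*-distribˡ-∣-∣ a j j′)))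

  position-separated : ∀ r {j j′} → j ≢ j′ → a ≤ ∣ position r j - position r j′ ∣
  position-separated r {j} {j′} j≢j′ = begin
    a                                  ≡⟨ *-identityʳ a ⟨
    a * 1                              ≤⟨ *-monoʳ-≤ a (n≢0⇒n>0 (λ ∣j-j′∣≡0 → j≢j′ (∣m-n∣≡0⇒m≡n ∣j-j′∣≡0))) ⟩
    a * ∣ j - j′ ∣                      ≡⟨ ∣position-position∣ r j j′ ⟨
    ∣ position r j - position r j′ ∣    ∎

  position<L : 1 ≤ h → ∀ r {j} → j < y₁ → position r j < L
  position<L 1≤h r {j} j<y₁ = ≤-<-trans (position≤a*k r j<y₁) (m<m+n (a * y₁) 1≤h)

  position<Cl : ∀ r {j} → j < y₂ → position r j < Cl
  position<Cl r {j} j<y₂ = ≤-<-trans (position≤a*k r j<y₂) (m<m+n (a * y₂) (s≤s z≤n))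

  h≤L∸position-head : ∀ {j} → j < y₁ → h ≤ L ∸ position head j
  h≤L∸position-head {j} j<y₁ =
    m+n≤o⇒m≤o∸n h (subst (_≤ L) (+-comm (position head j) h) (+-monoˡ-≤ h (a*j+a≤a*k j<y₁)))

  1+h≤L∸position-tail : ∀ {j} → j < y₁ → suc h ≤ L ∸ position tail j
  1+h≤L∸position-tail {j} j<y₁ = m+n≤o⇒m≤o∸n (suc h) (begin
    suc h + (a * j + (h + h))   ≡⟨ rearrange h (a * j) ⟩
    a * j + a + h               ≤⟨ +-monoˡ-≤ h (a*j+a≤a*k j<y₁) ⟩
    L                           ∎)
    where
    rearrange : ∀ h x → suc h + (x + (h + h)) ≡ x + suc (h + h) + h
    rearrange = solve-∀

  1+h≤hub-position-loop : ∀ {j} → j < y₂ → suc h ≤ position loop j ⊓ (Cl ∸ position loop j)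
  1+h≤hub-position-loop {j} j<y₂ = ⊓-glb (m≤n+m (suc h) (a * j)) (m+n≤o⇒m≤o∸n (suc h) (begin
    suc h + (a * j + suc h)   ≡⟨ rearrange h (a * j) ⟩
    a * j + a + 1             ≤⟨ +-monoˡ-≤ 1 (a*j+a≤a*k j<y₂) ⟩
    Cl                        ∎))
    where
    rearrange : ∀ h x → suc h + (x + suc h) ≡ x + suc (h + h) + 1
    rearrange = solve-∀

  a≤Cl∸∣position-position∣ : ∀ {j j′} → j < y₂ → j′ < y₂ →
                             a ≤ Cl ∸ ∣ position loop j - position loop j′ ∣
  a≤Cl∸∣position-position∣ {j} {j′} j<y₂ j′<y₂ = m+n≤o⇒m≤o∸n a (begin
    a + ∣ position loop j - position loop j′ ∣   ≡⟨ cong (a +_) (∣position-position∣ loop j j′) ⟩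
    a + a * ∣ j - j′ ∣                           ≡⟨ +-comm a _ ⟩
    a * ∣ j - j′ ∣ + a                           ≤⟨ a*j+a≤a*k (≤-<-trans (∣m-n∣≤m⊔n j j′) (⊔-lub j<y₂ j′<y₂)) ⟩
    a * y₂                                       ≤⟨ m≤m+n (a * y₂) 1 ⟩
    Cl                                           ∎)

module Gadgets (b-1 x₁ x₂ n m : ℕ) (endsH : Fin m → Fin n × Fin n) (h y₁ y₂ : ℕ)
  (1≤h : 1 ≤ h) (1≤y₁ : 1 ≤ y₁)
  (x₁b≡L : x₁ * suc b-1 ≡ Placement.L h y₁ y₂) (x₂b≡Cl : x₂ * suc b-1 ≡ Placement.Cl h y₁ y₂)
  (I : Fin n → Set) (I? : Decidable I)
  (independent : ∀ e → I (proj₁ (endsH e)) → I (proj₂ (endsH e)) → ⊥)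
  (loopless : ∀ e → proj₁ (endsH e) ≢ proj₂ (endsH e)) where

  open Construction n m x₁ x₂ endsH using (G)
  open NonExpandingMaps
  open Scaled b-1 using (b; ⟦_⟧)
  open Potentials b-1 x₁ x₂ n m endsH
  open Placement h y₁ y₂
  open import Data.Nat using (_+_; _∸_; _<_; z≤n; s≤s; ∣_-_∣; _⊓_)
  open import Data.Nat.Properties
  open import Data.Fin as Fin using ()
  open import Data.Bool using (if_then_else_)
  open import Data.Empty using (⊥-elim)
  open import Data.Unit using (tt)
  open import Data.Integer using (+_)
  open import Relation.Binary.PropositionalEquality
  open import Relation.Nullary using (yes; no; ⌊_⌋)

  u₀ v₀ : Fin m → Fin n
  u₀ e = proj₁ (endsH e)
  v₀ e = proj₂ (endsH e)

  -- The path towards an endpoint in I, if any, gets the head slots, which stay a / b away from that endpoint.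
  role : Fin m → Arm → Role
  role e armU with I? (v₀ e)
  ... | yes _ = tail
  ... | no  _ = head
  role e armV with I? (v₀ e)
  ... | yes _ = head
  ... | no  _ = tail
  role e armC = loop

  role-head-U : ∀ e → I (u₀ e) → role e armU ≡ head
  role-head-U e u∈I with I? (v₀ e)
  ... | yes v∈I = ⊥-elim (independent e u∈I v∈I)
  ... | no  _   = refl

  role-head-V : ∀ e → I (v₀ e) → role e armV ≡ head
  role-head-V e v∈I with I? (v₀ e)
  ... | yes _   = refl
  ... | no  v∉I = ⊥-elim (v∉I v∈I)

  slots : Arm → ℕ
  slots armU = y₁
  slots armV = y₁
  slots armC = y₂

  span : Arm → ℕ
  span armU = L
  span armV = L
  span armC = Cl

  edges*b≡span : ∀ B → edges B * b ≡ span B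
  edges*b≡span armU = x₁b≡L
  edges*b≡span armV = x₁b≡L
  edges*b≡span armC = x₂b≡Cl

  slot : Fin m → Arm → ℕ → ℕ
  slot e B j = position (role e B) j

  slot<span : ∀ e B {j} → j < slots B → slot e B j < span B
  slot<span e armU = position<L 1≤h (role e armU)
  slot<span e armV = position<L 1≤h (role e armV)
  slot<span e armC = position<Cl loop

  slot-inRange : ∀ e B {j} → j < slots B → InRange (onArm e B (slot e B j))
  slot-inRange e B j<slots = subst (slot e B _ <_) (sym (edges*b≡span B)) (slot<span e B j<slots)

  data Pick : Set where
    starPick : Fin n → Pick
    slotPick : Fin m → Arm → ℕ → Pick

  place : Pick → Place
  place (starPick v)     = star v
  place (slotPick e B j) = onArm e B (slot e B j)

  Legal : Pick → Set
  Legal (starPick v)     = I v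
  Legal (slotPick e B j) = j < slots B

  place-inRange : ∀ p → Legal p → InRange (place p)
  place-inRange (starPick v)     _        = tt
  place-inRange (slotPick e B j) j<slots = slot-inRange e B j<slots

  a≤a⊓_ : ∀ {k} → a ≤ k → a ≤ a ⊓ k
  a≤a⊓ a≤k = ⊓-glb ≤-refl a≤k

  a≤k+L : ∀ k → a ≤ k + L
  a≤k+L k = ≤-trans (a≤L 1≤y₁) (m≤n+m L k)

  a≤head : ∀ e B {j} → role e B ≡ head → a ≤ slot e B j
  a≤head e B {j} is-head = subst (λ r → a ≤ position r j) (sym is-head) (a≤position-head j)

  a≤1+slot : ∀ e B j → B ≢ armC → a ≤ suc (slot e B j)
  a≤1+slot e armU j _ with I? (v₀ e)
  ... | yes _ = a≤1+position-tail j
  ... | no  _ = ≤-trans (a≤position-head j) (n≤1+n _)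
  a≤1+slot e armV j _ with I? (v₀ e)
  ... | yes _ = ≤-trans (a≤position-head j) (n≤1+n _)
  ... | no  _ = a≤1+position-tail j
  a≤1+slot e armC j C≢C = ⊥-elim (C≢C refl)

  -- Distance (times b) from a point of an arm to e*, inside the gadget.
  toHub : Arm → ℕ → ℕ
  toHub armU x = L ∸ x
  toHub armV x = L ∸ x
  toHub armC x = x ⊓ (Cl ∸ x)

  toHub-nonExpanding : ∀ B → NonExpanding (toHub B)
  toHub-nonExpanding armU = ∸-nonExpanding L id-nonExpanding
  toHub-nonExpanding armV = ∸-nonExpanding L id-nonExpanding
  toHub-nonExpanding armC = ⊓-nonExpanding id-nonExpanding (∸-nonExpanding Cl id-nonExpanding)

  minHub : Role → ℕ
  minHub head = h
  minHub tail = suc h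
  minHub loop = suc h

  h≤minHub : ∀ r → h ≤ minHub r
  h≤minHub head = ≤-refl
  h≤minHub tail = n≤1+n h
  h≤minHub loop = n≤1+n h

  minHub≤toHub : ∀ e B {j} → j < slots B → minHub (role e B) ≤ toHub B (slot e B j)
  minHub≤toHub e armU j<y₁ with I? (v₀ e)
  ... | yes _ = 1+h≤L∸position-tail j<y₁
  ... | no  _ = h≤L∸position-head j<y₁
  minHub≤toHub e armV j<y₁ with I? (v₀ e)
  ... | yes _ = h≤L∸position-head j<y₁
  ... | no  _ = 1+h≤L∸position-tail j<y₁
  minHub≤toHub e armC j<y₂ = 1+h≤hub-position-loop j<y₂

  a≤minHub+minHub : ∀ e A B → A ≢ B → a ≤ minHub (role e A) + minHub (role e B)
  a≤minHub+minHub e armU armV _ with I? (v₀ e)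
  ... | yes _ = ≤-refl
  ... | no  _ = ≤-reflexive (sym (+-suc h h))
  a≤minHub+minHub e armV armU _ with I? (v₀ e)
  ... | yes _ = ≤-reflexive (sym (+-suc h h))
  ... | no  _ = ≤-refl
  a≤minHub+minHub e armU armC _ = ≤-trans (≤-reflexive (sym (+-suc h h))) (+-monoˡ-≤ (suc h) (h≤minHub (role e armU)))
  a≤minHub+minHub e armV armC _ = ≤-trans (≤-reflexive (sym (+-suc h h))) (+-monoˡ-≤ (suc h) (h≤minHub (role e armV)))
  a≤minHub+minHub e armC armU _ = s≤s (+-monoʳ-≤ h (h≤minHub (role e armU)))
  a≤minHub+minHub e armC armV _ = s≤s (+-monoʳ-≤ h (h≤minHub (role e armV)))
  a≤minHub+minHub e armU armU U≢U = ⊥-elim (U≢U refl)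
  a≤minHub+minHub e armV armV V≢V = ⊥-elim (V≢V refl)
  a≤minHub+minHub e armC armC C≢C = ⊥-elim (C≢C refl)

  a≤toHub+toHub : ∀ e A B {j j′} → A ≢ B → j < slots A → j′ < slots B →
                  a ≤ toHub A (slot e A j) + toHub B (slot e B j′)
  a≤toHub+toHub e A B A≢B j<slots j′<slots =
    ≤-trans (a≤minHub+minHub e A B A≢B) (+-mono-≤ (minHub≤toHub e A j<slots) (minHub≤toHub e B j′<slots))

  outer : (Fin n → ℕ) → Fin m → Arm → ℕ → ℕ
  outer s e armU x = a ⊓ (s (u₀ e) + x)
  outer s e armV x = a ⊓ (s (v₀ e) + x)
  outer s e armC x = a

  outer-nonExpanding : ∀ s e B → NonExpanding (outer s e B)
  outer-nonExpanding s e armU = ⊓-nonExpanding (const-nonExpanding a) (+-nonExpanding (s (u₀ e)) id-nonExpanding)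
  outer-nonExpanding s e armV = ⊓-nonExpanding (const-nonExpanding a) (+-nonExpanding (s (v₀ e)) id-nonExpanding)
  outer-nonExpanding s e armC = const-nonExpanding a

  a⊓[k+0]≡k : ∀ {k} → k ≤ a → a ⊓ (k + 0) ≡ k
  a⊓[k+0]≡k {k} k≤a = trans (cong (a ⊓_) (+-identityʳ k)) (m≥n⇒m⊓n≡n k≤a)

  a⊓[k+x₁b]≡a : ∀ k → a ⊓ (k + x₁ * b) ≡ a
  a⊓[k+x₁b]≡a k = m≤n⇒m⊓n≡m (≤-trans (a≤L 1≤y₁) (subst (_≤ k + x₁ * b) x₁b≡L (m≤n+m (x₁ * b) k)))

  pointedAt : Fin n → Fin n → ℕ
  pointedAt w v = if ⌊ v Fin.≟ w ⌋ then 0 else a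

  pointedAt≤a : ∀ w v → pointedAt w v ≤ a
  pointedAt≤a w v with v Fin.≟ w
  ... | yes _ = z≤n
  ... | no  _ = ≤-refl

  module StarPotential (w : Fin n) (w∈I : I w) where

    potential : Potential
    potential = record
      { atStar = pointedAt w
      ; along  = outer (pointedAt w)
      ; startU = λ e → sym (a⊓[k+0]≡k (pointedAt≤a w (u₀ e)))
      ; startV = λ e → sym (a⊓[k+0]≡k (pointedAt≤a w (v₀ e)))
      ; endU   = λ e → a⊓[k+x₁b]≡a _
      ; endV   = λ e → a⊓[k+x₁b]≡a _
      ; endC   = λ e → refl
      ; along-nonExpanding = outer-nonExpanding (pointedAt w)
      }

    vanishes : valueAt potential (place (starPick w)) ≡ 0
    vanishes with w Fin.≟ w
    ... | yes _   = refl
    ... | no  w≢w = ⊥-elim (w≢w refl)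

    far-slot : ∀ e B j → a ≤ outer (pointedAt w) e B (slot e B j)
    far-slot e armU j with u₀ e Fin.≟ w
    ... | yes refl = a≤a⊓ a≤head e armU (role-head-U e w∈I)
    ... | no  _    = a≤a⊓ m≤m+n a _
    far-slot e armV j with v₀ e Fin.≟ w
    ... | yes refl = a≤a⊓ a≤head e armV (role-head-V e w∈I)
    ... | no  _    = a≤a⊓ m≤m+n a _
    far-slot e armC j = ≤-refl

    far : ∀ p → starPick w ≢ p → a ≤ valueAt potential (place p)
    far (starPick v) w≢v with v Fin.≟ w
    ... | yes refl = ⊥-elim (w≢v refl)
    ... | no  _    = ≤-refl
    far (slotPick e B j) _ = far-slot e B j

  -- An upper bound (times b) for the distance inside a gadget between position σ of arm A and x of arm B.
  gadgetDist : Arm → ℕ → Arm → ℕ → ℕ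
  gadgetDist armU σ armU x = ∣ σ - x ∣
  gadgetDist armV σ armV x = ∣ σ - x ∣
  gadgetDist armC σ armC x = ∣ σ - x ∣ ⊓ (Cl ∸ ∣ σ - x ∣)
  gadgetDist A    σ B    x = toHub A σ + toHub B x

  gadgetDist-nonExpanding : ∀ A σ B → NonExpanding (gadgetDist A σ B)
  gadgetDist-nonExpanding armU σ armU = ∣-∣-nonExpanding σ
  gadgetDist-nonExpanding armV σ armV = ∣-∣-nonExpanding σ
  gadgetDist-nonExpanding armC σ armC = ⊓-nonExpanding (∣-∣-nonExpanding σ) (∸-nonExpanding Cl (∣-∣-nonExpanding σ))
  gadgetDist-nonExpanding armU σ armV = +-nonExpanding _ (toHub-nonExpanding armV)
  gadgetDist-nonExpanding armU σ armC = +-nonExpanding _ (toHub-nonExpanding armC)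
  gadgetDist-nonExpanding armV σ armU = +-nonExpanding _ (toHub-nonExpanding armU)
  gadgetDist-nonExpanding armV σ armC = +-nonExpanding _ (toHub-nonExpanding armC)
  gadgetDist-nonExpanding armC σ armU = +-nonExpanding _ (toHub-nonExpanding armU)
  gadgetDist-nonExpanding armC σ armV = +-nonExpanding _ (toHub-nonExpanding armV)

  gadgetDist-self : ∀ A σ → gadgetDist A σ A σ ≡ 0
  gadgetDist-self armU σ = ∣n-n∣≡0 σ
  gadgetDist-self armV σ = ∣n-n∣≡0 σ
  gadgetDist-self armC σ = cong (_⊓ (Cl ∸ ∣ σ - σ ∣)) (∣n-n∣≡0 σ)

  gadgetDist-hubU : ∀ A σ → σ ≤ span A → gadgetDist A σ armU L ≡ toHub A σ
  gadgetDist-hubU armU σ σ≤L = m≤n⇒∣m-n∣≡n∸m σ≤L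
  gadgetDist-hubU armV σ _   = trans (cong (λ d → toHub armV σ + d) (n∸n≡0 L)) (+-identityʳ _)
  gadgetDist-hubU armC σ _   = trans (cong (λ d → toHub armC σ + d) (n∸n≡0 L)) (+-identityʳ _)

  gadgetDist-hubV : ∀ A σ → σ ≤ span A → gadgetDist A σ armV L ≡ toHub A σ
  gadgetDist-hubV armU σ _   = trans (cong (λ d → toHub armU σ + d) (n∸n≡0 L)) (+-identityʳ _)
  gadgetDist-hubV armV σ σ≤L = m≤n⇒∣m-n∣≡n∸m σ≤L
  gadgetDist-hubV armC σ _   = trans (cong (λ d → toHub armC σ + d) (n∸n≡0 L)) (+-identityʳ _)

  gadgetDist-hubC₀ : ∀ A σ → gadgetDist A σ armC 0 ≡ toHub A σ
  gadgetDist-hubC₀ armU σ = +-identityʳ _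
  gadgetDist-hubC₀ armV σ = +-identityʳ _
  gadgetDist-hubC₀ armC σ = cong (λ d → d ⊓ (Cl ∸ d)) (∣-∣-identityʳ σ)

  gadgetDist-hubCl : ∀ A σ → σ ≤ span A → gadgetDist A σ armC Cl ≡ toHub A σ
  gadgetDist-hubCl armU σ _ = trans (cong (λ d → toHub armU σ + Cl ⊓ d) (n∸n≡0 Cl))
                                    (trans (cong (λ d → toHub armU σ + d) (⊓-zeroʳ Cl)) (+-identityʳ _))
  gadgetDist-hubCl armV σ _ = trans (cong (λ d → toHub armV σ + Cl ⊓ d) (n∸n≡0 Cl))
                                    (trans (cong (λ d → toHub armV σ + d) (⊓-zeroʳ Cl)) (+-identityʳ _))
  gadgetDist-hubCl armC σ σ≤Cl = begin
    ∣ σ - Cl ∣ ⊓ (Cl ∸ ∣ σ - Cl ∣)    ≡⟨ cong (λ d → d ⊓ (Cl ∸ d)) (m≤n⇒∣m-n∣≡n∸m σ≤Cl) ⟩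
    (Cl ∸ σ) ⊓ (Cl ∸ (Cl ∸ σ))       ≡⟨ cong ((Cl ∸ σ) ⊓_) (m∸[m∸n]≡n σ≤Cl) ⟩
    (Cl ∸ σ) ⊓ σ                     ≡⟨ ⊓-comm (Cl ∸ σ) σ ⟩
    σ ⊓ (Cl ∸ σ)                     ∎
    where open ≡-Reasoning

  a≤gadgetDist-slots : ∀ e A B {j j′} → j < slots A → j′ < slots B → (A ≡ B → j ≢ j′) →
                       a ≤ gadgetDist A (slot e A j) B (slot e B j′)
  a≤gadgetDist-slots e armU armU _ _ j≢j′ = position-separated (role e armU) (j≢j′ refl)
  a≤gadgetDist-slots e armV armV _ _ j≢j′ = position-separated (role e armV) (j≢j′ refl)
  a≤gadgetDist-slots e armC armC j<y₂ j′<y₂ j≢j′ =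
    ⊓-glb (position-separated loop (j≢j′ refl)) (a≤Cl∸∣position-position∣ j<y₂ j′<y₂)
  a≤gadgetDist-slots e armU armV j<slots j′<slots _ = a≤toHub+toHub e armU armV (λ ()) j<slots j′<slots
  a≤gadgetDist-slots e armU armC j<slots j′<slots _ = a≤toHub+toHub e armU armC (λ ()) j<slots j′<slots
  a≤gadgetDist-slots e armV armU j<slots j′<slots _ = a≤toHub+toHub e armV armU (λ ()) j<slots j′<slots
  a≤gadgetDist-slots e armV armC j<slots j′<slots _ = a≤toHub+toHub e armV armC (λ ()) j<slots j′<slots
  a≤gadgetDist-slots e armC armU j<slots j′<slots _ = a≤toHub+toHub e armC armU (λ ()) j<slots j′<slots
  a≤gadgetDist-slots e armC armV j<slots j′<slots _ = a≤toHub+toHub e armC armV (λ ()) j<slots j′<slots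

  a≤gadgetDist-U₀ : ∀ e A j → I (u₀ e) → a ≤ gadgetDist A (slot e A j) armU 0
  a≤gadgetDist-U₀ e armU j u∈I =
    subst (a ≤_) (sym (∣-∣-identityʳ (slot e armU j))) (a≤head e armU (role-head-U e u∈I))
  a≤gadgetDist-U₀ e armV j _   = a≤k+L (toHub armV (slot e armV j))
  a≤gadgetDist-U₀ e armC j _   = a≤k+L (toHub armC (slot e armC j))

  a≤gadgetDist-V₀ : ∀ e A j → I (v₀ e) → a ≤ gadgetDist A (slot e A j) armV 0
  a≤gadgetDist-V₀ e armU j _   = a≤k+L (toHub armU (slot e armU j))
  a≤gadgetDist-V₀ e armV j v∈I =
    subst (a ≤_) (sym (∣-∣-identityʳ (slot e armV j))) (a≤head e armV (role-head-V e v∈I))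
  a≤gadgetDist-V₀ e armC j _   = a≤k+L (toHub armC (slot e armC j))

  a≤1+gadgetDist-U₀ : ∀ e A j → a ≤ suc (gadgetDist A (slot e A j) armU 0)
  a≤1+gadgetDist-U₀ e armU j =
    subst (λ d → a ≤ suc d) (sym (∣-∣-identityʳ (slot e armU j))) (a≤1+slot e armU j (λ ()))
  a≤1+gadgetDist-U₀ e armV j = ≤-trans (a≤k+L (toHub armV (slot e armV j))) (n≤1+n _)
  a≤1+gadgetDist-U₀ e armC j = ≤-trans (a≤k+L (toHub armC (slot e armC j))) (n≤1+n _)

  a≤1+gadgetDist-V₀ : ∀ e A j → a ≤ suc (gadgetDist A (slot e A j) armV 0)
  a≤1+gadgetDist-V₀ e armU j = ≤-trans (a≤k+L (toHub armU (slot e armU j))) (n≤1+n _)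
  a≤1+gadgetDist-V₀ e armV j =
    subst (λ d → a ≤ suc d) (sym (∣-∣-identityʳ (slot e armV j))) (a≤1+slot e armV j (λ ()))
  a≤1+gadgetDist-V₀ e armC j = ≤-trans (a≤k+L (toHub armC (slot e armC j))) (n≤1+n _)

  module SlotPotential (pe : Fin m) (A : Arm) (j : ℕ) (j<slots : j < slots A) where

    σ : ℕ
    σ = slot pe A j

    σ≤span : σ ≤ span A
    σ≤span = <⇒≤ (slot<span pe A j<slots)

    near : Arm → ℕ → ℕ
    near B x = a ⊓ gadgetDist A σ B x

    stars : Fin n → ℕ
    stars v = if ⌊ v Fin.≟ u₀ pe ⌋ then near armU 0 else if ⌊ v Fin.≟ v₀ pe ⌋ then near armV 0 else a

    along : Fin m → Arm → ℕ → ℕ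
    along e B x = if ⌊ e Fin.≟ pe ⌋ then near B x else outer stars e B x

    stars≤a : ∀ v → stars v ≤ a
    stars≤a v with v Fin.≟ u₀ pe | v Fin.≟ v₀ pe
    ... | yes _ | _     = m⊓n≤m a _
    ... | no  _ | yes _ = m⊓n≤m a _
    ... | no  _ | no  _ = ≤-refl

    startU : ∀ e → stars (u₀ e) ≡ along e armU 0
    startU e with e Fin.≟ pe
    ... | no  _    = sym (a⊓[k+0]≡k (stars≤a (u₀ e)))
    ... | yes refl with u₀ pe Fin.≟ u₀ pe
    ...   | yes _   = refl
    ...   | no  u≢u = ⊥-elim (u≢u refl)

    startV : ∀ e → stars (v₀ e) ≡ along e armV 0
    startV e with e Fin.≟ pe
    ... | no  _    = sym (a⊓[k+0]≡k (stars≤a (v₀ e)))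
    ... | yes refl with v₀ pe Fin.≟ u₀ pe | v₀ pe Fin.≟ v₀ pe
    ...   | yes v≡u | _       = ⊥-elim (loopless pe (sym v≡u))
    ...   | no  _   | yes _   = refl
    ...   | no  _   | no  v≢v = ⊥-elim (v≢v refl)

    endU : ∀ e → along e armU (x₁ * b) ≡ along e armC 0
    endU e with e Fin.≟ pe
    ... | no  _    = a⊓[k+x₁b]≡a _
    ... | yes refl = cong (a ⊓_) (trans (cong (gadgetDist A σ armU) x₁b≡L)
                                 (trans (gadgetDist-hubU A σ σ≤span) (sym (gadgetDist-hubC₀ A σ))))

    endV : ∀ e → along e armV (x₁ * b) ≡ along e armC 0
    endV e with e Fin.≟ pe
    ... | no  _    = a⊓[k+x₁b]≡a _
    ... | yes refl = cong (a ⊓_) (trans (cong (gadgetDist A σ armV) x₁b≡L)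
                                 (trans (gadgetDist-hubV A σ σ≤span) (sym (gadgetDist-hubC₀ A σ))))

    endC : ∀ e → along e armC (x₂ * b) ≡ along e armC 0
    endC e with e Fin.≟ pe
    ... | no  _    = refl
    ... | yes refl = cong (a ⊓_) (trans (cong (gadgetDist A σ armC) x₂b≡Cl)
                                 (trans (gadgetDist-hubCl A σ σ≤span) (sym (gadgetDist-hubC₀ A σ))))

    along-nonExpanding : ∀ e B → NonExpanding (along e B)
    along-nonExpanding e B with e Fin.≟ pe
    ... | no  _ = outer-nonExpanding stars e B
    ... | yes _ = ⊓-nonExpanding (const-nonExpanding a) (gadgetDist-nonExpanding A σ B)

    potential : Potential
    potential = record
      { atStar = stars ; along = along ; startU = startU ; startV = startV
      ; endU = endU ; endV = endV ; endC = endC ; along-nonExpanding = along-nonExpanding }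

    vanishes : valueAt potential (place (slotPick pe A j)) ≡ 0
    vanishes with pe Fin.≟ pe
    ... | yes _     = trans (cong (a ⊓_) (gadgetDist-self A σ)) (⊓-zeroʳ a)
    ... | no  pe≢pe = ⊥-elim (pe≢pe refl)

    a≤1+stars : ∀ v → a ≤ suc (stars v)
    a≤1+stars v with v Fin.≟ u₀ pe | v Fin.≟ v₀ pe
    ... | yes _ | _     = ⊓-glb (n≤1+n a) (a≤1+gadgetDist-U₀ pe A j)
    ... | no  _ | yes _ = ⊓-glb (n≤1+n a) (a≤1+gadgetDist-V₀ pe A j)
    ... | no  _ | no  _ = n≤1+n a

    a≤stars : ∀ v → I v → a ≤ stars v
    a≤stars v v∈I with v Fin.≟ u₀ pe | v Fin.≟ v₀ pe
    ... | yes refl | _        = a≤a⊓ a≤gadgetDist-U₀ pe A j v∈I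
    ... | no  _    | yes refl = a≤a⊓ a≤gadgetDist-V₀ pe A j v∈I
    ... | no  _    | no  _    = ≤-refl

    a≤stars+ : ∀ v {x} → 1 ≤ x → a ≤ stars v + x
    a≤stars+ v {x} 1≤x = ≤-trans (a≤1+stars v) (subst (_≤ stars v + x) (+-comm (stars v) 1) (+-monoʳ-≤ (stars v) 1≤x))

    a≤outer : ∀ e B j′ → a ≤ outer stars e B (slot e B j′)
    a≤outer e armU j′ = a≤a⊓ a≤stars+ (u₀ e) (1≤position 1≤h (role e armU) j′)
    a≤outer e armV j′ = a≤a⊓ a≤stars+ (v₀ e) (1≤position 1≤h (role e armV) j′)
    a≤outer e armC j′ = ≤-refl

    far : ∀ p → Legal p → slotPick pe A j ≢ p → a ≤ valueAt potential (place p)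
    far (starPick v) v∈I _ = a≤stars v v∈I
    far (slotPick e B j′) j′<slots ≢p with e Fin.≟ pe
    ... | no  _    = a≤outer e B j′
    ... | yes refl = a≤a⊓ a≤gadgetDist-slots pe A B j<slots j′<slots (λ { refl refl → ≢p refl })

  picks-apart : ∀ p q → Legal p → Legal q → p ≢ q → AtLeastApart G ⟦ + a ⟧ (point (place p)) (point (place q))
  picks-apart (starPick w) q w∈I q-legal p≢q =
    separation (StarPotential.potential w w∈I) tt (place-inRange q q-legal)
               (StarPotential.vanishes w w∈I) (StarPotential.far w w∈I q p≢q)
  picks-apart (slotPick e A j) q j<slots q-legal p≢q =
    separation (SlotPotential.potential e A j j<slots) (slot-inRange e A j<slots) (place-inRange q q-legal)
               (SlotPotential.vanishes e A j j<slots) (SlotPotential.far e A j j<slots q q-legal p≢q)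

module ListFacts where

  open import Data.Nat using (_+_; _*_)
  open import Data.List using ([]; _∷_; map; length; cartesianProductWith)
  open import Data.List.Properties using (length-++; length-map)
  open import Data.List.Membership.Propositional using (_∈_)
  open import Data.List.Relation.Unary.All as All using (All; []; _∷_)
  open import Data.List.Relation.Unary.Any using (here; there)
  open import Data.List.Relation.Unary.AllPairs using (AllPairs; []; _∷_)
  open import Data.List.Relation.Unary.Unique.Propositional using (Unique)
  open import Data.Product using (_,_)
  open import Data.Sum using (_⊎_; inj₁; inj₂)
  open import Data.Empty using (⊥-elim)
  open import Relation.Binary.PropositionalEquality using (_≡_; _≢_; refl; cong₂; trans)

  module _ {A : Set} {R : A → A → Set} where

    AllPairs-∈ : ∀ {xs x y} → AllPairs R xs → x ∈ xs → y ∈ xs → x ≢ y → R x y ⊎ R y x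
    AllPairs-∈ (_ ∷ _)      (here refl) (here refl) x≢x = ⊥-elim (x≢x refl)
    AllPairs-∈ (Rx ∷ _)     (here refl) (there y∈) _    = inj₁ (All.lookup Rx y∈)
    AllPairs-∈ (Ry ∷ _)     (there x∈)  (here refl) _   = inj₂ (All.lookup Ry x∈)
    AllPairs-∈ (_ ∷ Rxs)    (there x∈)  (there y∈) x≢y  = AllPairs-∈ Rxs x∈ y∈ x≢y

    AllPairs-≢ : ∀ {V : A → Set} → (∀ {x y} → V x → V y → x ≢ y → R x y) →
                 ∀ {xs} → All V xs → Unique xs → AllPairs R xs
    AllPairs-≢ f []         []            = []
    AllPairs-≢ f (Vx ∷ Vxs) (x∉xs ∷ uxs) =
      All.zipWith (λ (Vy , x≢y) → f Vx Vy x≢y) (Vxs , x∉xs) ∷ AllPairs-≢ f Vxs uxs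

  length-cartesianProductWith : {A B C : Set} (f : A → B → C) → ∀ xs ys →
                                length (cartesianProductWith f xs ys) ≡ length xs * length ys
  length-cartesianProductWith f []       ys = refl
  length-cartesianProductWith f (x ∷ xs) ys =
    trans (length-++ (map (f x) ys)) (cong₂ _+_ (length-map (f x) ys) (length-cartesianProductWith f xs ys))

module Assembly (b-1 x₁ x₂ n m : ℕ) (endsH : Fin m → Fin n × Fin n) (h y₁ y₂ : ℕ)
  (1≤h : 1 ≤ h) (1≤y₁ : 1 ≤ y₁)
  (x₁b≡L : x₁ * suc b-1 ≡ Placement.L h y₁ y₂) (x₂b≡Cl : x₂ * suc b-1 ≡ Placement.Cl h y₁ y₂)
  (I : List (Fin n)) (I-unique : Unique I) (I-independent : AllPairs (λ u w → ¬ Adj (HGraph n m endsH) u w) I)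
  (loopless : ∀ e → proj₁ (endsH e) ≢ proj₂ (endsH e)) where

  open ListFacts
  open Apartness
  open import Data.Nat.Properties using (+-assoc; +-identityʳ; *-comm; ≤-reflexive)
  open import Data.Nat using (_+_; _<_; s≤s; z≤n)
  open import Data.Fin.Properties using (_≟_)
  import Data.Integer as ℤ
  open Scaled b-1 using (0<⟦⟧)
  open import Data.Rational using (_/_)
  open import Data.Product using (_,_)
  open import Data.Sum using (inj₁; inj₂)
  open import Data.List using (length; _++_; map; upTo; allFin; cartesianProductWith)
  open import Data.List.Properties using (length-++; length-map; length-upTo; length-tabulate)
  open import Data.List.Membership.Propositional using (_∈_)
  open import Data.List.Membership.Propositional.Properties using (∈-map⁻; ∈-++⁻; ∈-cartesianProductWith⁻; ∈-upTo⁻)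
  open import Data.List.Membership.DecPropositional (_≟_ {n}) using (_∈?_)
  open import Data.List.Relation.Unary.All as All using (All)
  import Data.List.Relation.Unary.All.Properties as All
  import Data.List.Relation.Unary.AllPairs.Properties as AllPairs
  import Data.List.Relation.Unary.Unique.Propositional.Properties as Unique
  open import Relation.Binary.PropositionalEquality using (refl; sym; trans; cong; cong₂; module ≡-Reasoning)

  independent : ∀ e → proj₁ (endsH e) ∈ I → proj₂ (endsH e) ∈ I → ⊥
  independent e u∈I v∈I with AllPairs-∈ I-independent u∈I v∈I (loopless e)
  ... | inj₁ ¬adj = ¬adj (e , inj₁ refl)
  ... | inj₂ ¬adj = ¬adj (e , inj₂ refl)

  open Placement h y₁ y₂ using (a)
  open Potentials b-1 x₁ x₂ n m endsH using (Arm; armU; armV; armC; point; point-valid)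
  open Gadgets b-1 x₁ x₂ n m endsH h y₁ y₂ 1≤h 1≤y₁ x₁b≡L x₂b≡Cl
    (_∈ I) (_∈? I) independent loopless

  slotsOf : Arm → List (Arm × ℕ)
  slotsOf B = map (B ,_) (upTo (slots B))

  ∈-slotsOf⁻ : ∀ {A B j} → (B , j) ∈ slotsOf A → B ≡ A × j < slots A
  ∈-slotsOf⁻ {A} B,j∈ with ∈-map⁻ (A ,_) B,j∈
  ... | j , j∈upTo , refl = refl , ∈-upTo⁻ j∈upTo

  slotsOf-unique : ∀ A → Unique (slotsOf A)
  slotsOf-unique A = Unique.map⁺ (λ { refl → refl }) (Unique.upTo⁺ (slots A))

  slotsOf-disjoint : ∀ {A B v} → A ≢ B → v ∈ slotsOf A → ¬ v ∈ slotsOf B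
  slotsOf-disjoint {v = _ , _} A≢B v∈A v∈B =
    A≢B (trans (sym (proj₁ (∈-slotsOf⁻ v∈A))) (proj₁ (∈-slotsOf⁻ v∈B)))

  allSlots : List (Arm × ℕ)
  allSlots = slotsOf armU ++ slotsOf armV ++ slotsOf armC

  slotsOf-legal : ∀ {A B j} → (B , j) ∈ slotsOf A → j < slots B
  slotsOf-legal B,j∈ with ∈-slotsOf⁻ B,j∈
  ... | refl , j<slots = j<slots

  allSlots-legal : ∀ {B j} → (B , j) ∈ allSlots → j < slots B
  allSlots-legal B,j∈ with ∈-++⁻ (slotsOf armU) B,j∈
  ... | inj₁ ∈U = slotsOf-legal ∈U
  ... | inj₂ ∈VC with ∈-++⁻ (slotsOf armV) ∈VC
  ...   | inj₁ ∈V = slotsOf-legal ∈V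
  ...   | inj₂ ∈C = slotsOf-legal ∈C

  allSlots-unique : Unique allSlots
  allSlots-unique = Unique.++⁺ (slotsOf-unique armU) (Unique.++⁺ (slotsOf-unique armV) (slotsOf-unique armC) V#C) U#VC
    where
    V#C : ∀ {v} → ¬ (v ∈ slotsOf armV × v ∈ slotsOf armC)
    V#C (∈V , ∈C) = slotsOf-disjoint (λ ()) ∈V ∈C
    U#VC : ∀ {v} → ¬ (v ∈ slotsOf armU × v ∈ slotsOf armV ++ slotsOf armC)
    U#VC (∈U , ∈VC) with ∈-++⁻ (slotsOf armV) ∈VC
    ... | inj₁ ∈V = slotsOf-disjoint (λ ()) ∈U ∈V
    ... | inj₂ ∈C = slotsOf-disjoint (λ ()) ∈U ∈C

  length-allSlots : length allSlots ≡ 2 * y₁ + y₂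
  length-allSlots = begin
    length allSlots                                 ≡⟨ length-++ (slotsOf armU) ⟩
    length (slotsOf armU) + length (slotsOf armV ++ slotsOf armC)
        ≡⟨ cong (length (slotsOf armU) +_) (length-++ (slotsOf armV)) ⟩
    length (slotsOf armU) + (length (slotsOf armV) + length (slotsOf armC))
        ≡⟨ cong₂ _+_ (length-slotsOf armU) (cong₂ _+_ (length-slotsOf armV) (length-slotsOf armC)) ⟩
    y₁ + (y₁ + y₂)                                  ≡⟨ +-assoc y₁ y₁ y₂ ⟨
    y₁ + y₁ + y₂                                    ≡⟨ cong (λ k → y₁ + k + y₂) (+-identityʳ y₁) ⟨
    2 * y₁ + y₂                                     ∎
    where
    open ≡-Reasoning
    length-slotsOf : ∀ A → length (slotsOf A) ≡ slots A
    length-slotsOf A = trans (length-map (A ,_) (upTo (slots A))) (length-upTo (slots A))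

  toSlotPick : Fin m → Arm × ℕ → Pick
  toSlotPick e (B , j) = slotPick e B j

  picks : List Pick
  picks = map starPick I ++ cartesianProductWith toSlotPick (allFin m) allSlots

  picks-legal : ∀ {p} → p ∈ picks → Legal p
  picks-legal p∈ with ∈-++⁻ (map starPick I) p∈
  ... | inj₁ ∈stars with ∈-map⁻ starPick ∈stars
  ...   | v , v∈I , refl = v∈I
  picks-legal p∈ | inj₂ ∈slots with ∈-cartesianProductWith⁻ toSlotPick (allFin m) allSlots ∈slots
  ...   | e , (B , j) , _ , B,j∈ , refl = allSlots-legal B,j∈

  picks-unique : Unique picks
  picks-unique = Unique.++⁺ (Unique.map⁺ (λ { refl → refl }) I-unique)
                            (Unique.cartesianProductWith⁺ toSlotPick (λ { refl → refl , refl })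
                                                          (Unique.allFin⁺ m) allSlots-unique)
                            stars#slots
    where
    stars#slots : ∀ {p} → ¬ (p ∈ map starPick I × p ∈ cartesianProductWith toSlotPick (allFin m) allSlots)
    stars#slots (∈stars , ∈slots)
      with ∈-map⁻ starPick ∈stars | ∈-cartesianProductWith⁻ toSlotPick (allFin m) allSlots ∈slots
    ... | _ , _ , refl | _ , (_ , _) , _ , _ , ()

  length-picks : length picks ≡ length I + (2 * y₁ + y₂) * m
  length-picks = begin
    length picks                                             ≡⟨ length-++ (map starPick I) ⟩
    length (map starPick I) + length (cartesianProductWith toSlotPick (allFin m) allSlots)
        ≡⟨ cong₂ _+_ (length-map starPick I) (length-cartesianProductWith toSlotPick (allFin m) allSlots) ⟩
    length I + length (allFin m) * length allSlots
        ≡⟨ cong₂ (λ k l → length I + k * l) (length-tabulate {n = m} (λ i → i)) length-allSlots ⟩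
    length I + m * (2 * y₁ + y₂)                             ≡⟨ cong (length I +_) (*-comm m (2 * y₁ + y₂)) ⟩
    length I + (2 * y₁ + y₂) * m                             ∎
    where open ≡-Reasoning

  points : List (Point (buildG n m x₁ x₂ endsH))
  points = map (λ p → point (place p)) picks

  points-apart : AllPairs (AtLeastApart (buildG n m x₁ x₂ endsH) (ℤ.+ a / suc b-1)) points
  points-apart = AllPairs.map⁺ (AllPairs-≢ (λ {p} {q} → picks-apart p q) (All.tabulate picks-legal) picks-unique)

  dispersed : DispAtLeast (buildG n m x₁ x₂ endsH) (ℤ.+ a / suc b-1) (length I + (2 * y₁ + y₂) * m)
  dispersed = points ,
              (All.map⁺ (All.tabulate (λ {p} _ → point-valid (place p))) ,
               apart⇒unique _ (0<⟦⟧ {a} (s≤s z≤n)) points-apart , points-apart) ,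
              ≤-reflexive (sym (trans (length-map _ picks) length-picks))

open import Data.Nat using (zero; _+_; _∸_; _<_; NonZero; s≤s; z≤n; ≢-nonZero⁻¹)
open import Data.Nat.Properties using (+-suc; *-comm; *-cancelˡ-≡)
open import Data.Nat.Tactic.RingSolver using (solve-∀)
open import Data.Nat.GCD using (gcd)
open import Data.Nat.Divisibility using (_∣_; divides)
open import Data.Product using (Σ; _,_)
open import Data.Empty using (⊥-elim)
open import Data.Integer using (+_)
open import Data.Rational using (_/_)
open import Relation.Binary.PropositionalEquality using (refl; sym; trans; cong; subst)

odd⇒≡1+2h : ∀ a → ¬ (2 ∣ a) → Σ ℕ λ h → a ≡ suc (h + h)
odd⇒≡1+2h zero          a-odd = ⊥-elim (a-odd (divides 0 refl))
odd⇒≡1+2h (suc zero)    _     = 0 , refl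
odd⇒≡1+2h (suc (suc a)) a-odd
  with odd⇒≡1+2h a (λ { (divides q a≡q*2) → a-odd (divides (suc q) (cong (λ k → suc (suc k)) a≡q*2)) })
... | h , refl = suc h , cong (λ k → suc (suc k)) (sym (+-suc h h))

x₁b≡ay₁+h : ∀ h b x₁ y₁ → 2 * b * x₁ ≡ 2 * suc (h + h) * y₁ + (h + h) → x₁ * b ≡ suc (h + h) * y₁ + h
x₁b≡ay₁+h h b x₁ y₁ eq = *-cancelˡ-≡ (x₁ * b) (suc (h + h) * y₁ + h) 2
  (trans (double₁ x₁ b) (trans eq (double₂ (suc (h + h)) y₁ h)))
  where
  double₁ : ∀ x b → 2 * (x * b) ≡ 2 * b * x
  double₁ = solve-∀
  double₂ : ∀ a y h → 2 * a * y + (h + h) ≡ 2 * (a * y + h)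
  double₂ = solve-∀

lemma4 : (a b : ℕ) .{{_ : NonZero b}} → 0 < a → gcd a b ≡ 1 → 3 ≤ a → ¬ (2 ∣ a) →
         (x₁ y₁ x₂ y₂ : ℕ) → 0 < x₁ → 0 < y₁ → 0 < x₂ → 0 < y₂ →
         2 * b * x₁ ≡ 2 * a * y₁ + (a ∸ 1) →
         b * x₂ ≡ a * y₂ + 1 →
         (n m : ℕ) (endsH : Fin m → Fin n × Fin n) →
         Simple (HGraph n m endsH) → Connected (HGraph n m endsH) →
         Cubic (HGraph n m endsH) →
         (k : ℕ) → HasIndependentSet (HGraph n m endsH) k →
         DispAtLeast (buildG n m x₁ x₂ endsH) ((+ a) / b) (k + (2 * y₁ + y₂) * m)
lemma4 a zero = ⊥-elim (≢-nonZero⁻¹ 0 refl)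
lemma4 a (suc b-1) _ _ 3≤a a-odd x₁ y₁ x₂ y₂ _ 0<y₁ _ _ eq₁ eq₂ n m endsH (loopless , _) _ _
       k (I , |I|≡k , I-unique , I-independent)
  with h , refl ← odd⇒≡1+2h a a-odd =
  subst (λ i → DispAtLeast (buildG n m x₁ x₂ endsH) (+ a / suc b-1) (i + (2 * y₁ + y₂) * m)) |I|≡k
    (Assembly.dispersed b-1 x₁ x₂ n m endsH h y₁ y₂ (1≤h 3≤a) 0<y₁
       (x₁b≡ay₁+h h (suc b-1) x₁ y₁ eq₁) (trans (*-comm x₂ (suc b-1)) eq₂) I I-unique I-independent loopless)
  where
  1≤h : ∀ {h} → 3 ≤ suc (h + h) → 1 ≤ h
  1≤h {zero}  (s≤s ())
  1≤h {suc h} _ = s≤s z≤n
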